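{- Let $P$ be an $n$-element poset. If $P$ is indecomposable, then $\{t_1,\dots,t_{n-1}\}$ is an inclusion-minimal generating set of $\mathcal{BK}_P$.
   Context: A linear extension of $P$ is a list $(p_1,\dots,p_n)$ of all elements of $P$ with $p_a<_P p_b$ implying $a<b$; ${\mathcal{L}}(P)$ is the set of these. The Bender--Knuth move $t_i$ ($1\le i\le n-1$) acts on ${\mathcal{L}}(P)$ by swapping $p_i,p_{i+1}$ if they are incomparable and fixing the list otherwise. $\mathcal{BK}_P$ is the permutation group on ${\mathcal{L}}(P)$ generated by $t_1,\dots,t_{n-1}$. A poset is indecomposable if it is not an ordinal sum $P_1\oplus P_2$ of two non-empty posets (where $P_1\oplus P_2$ places every element of $P_1$ below every element of $P_2$). -}

module Defs where

open import Data.Nat using (ℕ; zero; suc; _≤_; _<_)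
open import Data.Fin using (Fin) renaming (_<_ to _<ᶠ_)
open import Data.List using (List; []; _∷_; length; lookup; foldr)
open import Data.List.Relation.Unary.All using (All)
open import Data.List.Relation.Binary.Permutation.Propositional using (_↭_)
open import Data.List using (allFin)
open import Data.Product using (Σ; ∃; _×_)
open import Data.Sum using (_⊎_)
open import Data.Bool using (Bool; true; false)
open import Relation.Nullary using (¬_; yes; no)
open import Relation.Binary.PropositionalEquality using (_≡_; _≢_)
open import Relation.Binary.Structures using (IsDecPartialOrder)
open import Relation.Binary.Definitions using (Decidable)

record FinPoset (n : ℕ) : Set₁ where
  field
    _≤P_ : Fin n → Fin n → Set
    isDecPartialOrder : IsDecPartialOrder _≡_ _≤P_

  open IsDecPartialOrder isDecPartialOrder public using (_≤?_)

  _<P_ : Fin n → Fin n → Set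
  x <P y = (x ≤P y) × (x ≢ y)

open FinPoset public

IsLinExt : ∀ {n} → FinPoset n → List (Fin n) → Set
IsLinExt {n} P l =
  (l ↭ allFin n) ×
  (∀ (a b : Fin (length l)) → _<P_ P (lookup l a) (lookup l b) → a <ᶠ b)

-- Bender–Knuth move at 0-based position k (i.e. t_{k+1}): swap the entries at
-- positions k and k+1 if they are incomparable, otherwise leave the list fixed.
bkAt : ∀ {n} → FinPoset n → ℕ → List (Fin n) → List (Fin n)
bkAt P zero (x ∷ y ∷ r) with _≤?_ P x y | _≤?_ P y x
... | no _  | no _  = y ∷ x ∷ r
... | yes _ | _     = x ∷ y ∷ r
... | no _  | yes _ = x ∷ y ∷ r
bkAt P zero l = l
bkAt P (suc k) [] = []
bkAt P (suc k) (x ∷ r) = x ∷ bkAt P k r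

-- t_i for 1 ≤ i ≤ n-1 (t_0 is never used; it only appears outside the range).
t : ∀ {n} → FinPoset n → ℕ → List (Fin n) → List (Fin n)
t P zero l = l
t P (suc k) l = bkAt P k l

ValidIndex : ℕ → ℕ → Set
ValidIndex n i = (1 ≤ i) × (suc i ≤ n)

act : ∀ {n} → FinPoset n → List ℕ → List (Fin n) → List (Fin n)
act P w l = foldr (t P) l w

-- S ⊆ {valid indices} generates BK_P: every element of BK_P (a composite of
-- generators t_1,…,t_{n-1}; these are involutions so inverses are not needed)
-- acts on L(P) as some composite of the t_i with i ∈ S.
Generates : ∀ {n} → FinPoset n → (ℕ → Set) → Set
Generates {n} P S =
  ∀ (w : List ℕ) → All (ValidIndex n) w →
  Σ (List ℕ) λ w' → All S w' ×
    (∀ l → IsLinExt P l → act P w l ≡ act P w' l)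

MinimalGenerating : ∀ {n} → FinPoset n → Set
MinimalGenerating {n} P =
  Generates P (ValidIndex n) ×
  (∀ j → ValidIndex n j →
     ¬ Generates P (λ i → ValidIndex n i × (i ≢ j)))

-- P is an ordinal sum P₁ ⊕ P₂ of two non-empty posets: the elements split into
-- two non-empty blocks (c x ≡ true: in P₁, c x ≡ false: in P₂) with every
-- element of P₁ strictly below every element of P₂.
Decomposable : ∀ {n} → FinPoset n → Set
Decomposable {n} P =
  Σ (Fin n → Bool) λ c →
    (∃ λ x → c x ≡ true) × (∃ λ y → c y ≡ false) ×
    (∀ x y → c x ≡ true → c y ≡ false → _<P_ P x y)

Indecomposable : ∀ {n} → FinPoset n → Set
Indecomposable P = ¬ Decomposable P

{-# OPTIONS --safe #-}
module Submission where

-- The t_i generate BK_P trivially, so the content is minimality.  For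
-- j = k + 1, every t_i with i ≠ j permutes the first j entries of a list among
-- themselves, so no word avoiding t_j moves an element across positions j and
-- j + 1, whereas t_j does so on a linear extension whose entries there are
-- incomparable.  Such an extension exists: cut a linear extension after its
-- first j entries into D and U; indecomposability gives d ∈ D and u ∈ U with
-- d ≰ u.  Replace d by a maximal element of D above it and u by a minimal
-- element of U below it; then (D ∖ d) d u (U ∖ u) is again a linear extension,
-- and d, u are incomparable.

open import Defs
open import Data.Nat using (ℕ; zero; suc; _≤_; _<_; z≤n; s≤s)
open import Data.Nat.Properties using (suc-injective)
open import Data.Fin using (Fin) renaming (_<_ to _<ᶠ_)
open import Data.List using (List; []; _∷_; [_]; _++_; length; lookup; take; foldr; allFin)
open import Data.List.Properties using (length-tabulate; ++-assoc; ∷-injectiveˡ)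
open import Data.List.Relation.Unary.All as All using (All; []; _∷_)
import Data.List.Relation.Unary.All.Properties as All
open import Data.List.Relation.Unary.AllPairs using (AllPairs; []; _∷_)
import Data.List.Relation.Unary.AllPairs.Properties as AllPairs
open import Data.List.Relation.Unary.Unique.Propositional using (Unique)
open import Data.List.Relation.Unary.Unique.Propositional.Properties using (allFin⁺)
open import Data.List.Membership.Propositional using (_∈_; _∉_; find)
open import Data.List.Membership.Propositional.Properties
  using (∈-∃++; ∈-++⁻; ∈-lookup; ∈-allFin)
open import Data.List.Relation.Unary.Any using (here; there)
open import Data.List.Relation.Binary.Permutation.Propositional
  using (_↭_; refl; prep; swap; trans; ↭-sym; ↭⇒↭ₛ; module PermutationReasoning)
open import Data.List.Relation.Binary.Permutation.Propositional.Properties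
  using (All-resp-↭; ∈-resp-↭; ↭-length; ++⁺ˡ; shift; drop-∷; ↭-singleton-inv)
import Data.List.Relation.Binary.Permutation.Setoid.Properties as Perm
import Data.List.Membership.DecPropositional as DecMembership
open import Data.Product using (∃; ∃₂; _×_; _,_; proj₂)
open import Data.Sum using (fromInj₂)
open import Data.Bool using (Bool; true; false)
open import Data.Bool.Properties using (T-≡; T-not-≡)
open import Data.Empty using (⊥-elim)
open import Function using (_∘_; id; flip)
open import Function.Bundles using (Equivalence)
open import Relation.Nullary using (¬_; yes; no)
open import Relation.Nullary.Decidable
  using (isYes; toWitness; fromWitness; toWitnessFalse; fromWitnessFalse)
open import Relation.Binary.Definitions using (Decidable)
open import Relation.Binary.Structures using (IsPartialOrder; IsDecPartialOrder)
import Relation.Binary.Construct.Flip.EqAndOrd as Flip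
open import Relation.Binary.PropositionalEquality
  using (_≡_; _≢_; refl; sym; cong; subst; setoid)
  renaming (trans to ≡-trans)
import Data.Fin.Properties as Fin

module _ {A : Set} where

  All-remove : ∀ {P : A → Set} xs {y ys} → All P (xs ++ y ∷ ys) → All P (xs ++ ys)
  All-remove xs p with pxs , _ ∷ pys ← All.++⁻ xs p = All.++⁺ pxs pys

  module _ {R : A → A → Set} where

    AllPairs-++⁻ : ∀ xs {ys} → AllPairs R (xs ++ ys) →
      AllPairs R xs × AllPairs R ys × All (λ x → All (R x) ys) xs
    AllPairs-++⁻ [] p = [] , p , []
    AllPairs-++⁻ (x ∷ xs) (px ∷ p) with pxs , pys , cross ← AllPairs-++⁻ xs p =
      All.++⁻ˡ xs px ∷ pxs , pys , All.++⁻ʳ xs px ∷ cross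

    AllPairs-remove : ∀ xs {y ys} → AllPairs R (xs ++ y ∷ ys) → AllPairs R (xs ++ ys)
    AllPairs-remove [] (_ ∷ p) = p
    AllPairs-remove (x ∷ xs) (px ∷ p) = All-remove xs px ∷ AllPairs-remove xs p

  split-at : ∀ i (xs : List A) → i < length xs →
    ∃ λ ys → ∃₂ λ z zs → length ys ≡ i × xs ≡ ys ++ z ∷ zs
  split-at zero (x ∷ xs) _ = [] , x , xs , refl , refl
  split-at (suc i) (x ∷ xs) (s≤s i<) with ys , z , zs , refl , refl ← split-at i xs i< =
    x ∷ ys , z , zs , refl , refl

  take-suc-length-++ : ∀ (xs : List A) {y} ys →
    take (suc (length xs)) (xs ++ y ∷ ys) ≡ xs ++ [ y ]
  take-suc-length-++ [] ys = refl
  take-suc-length-++ (x ∷ xs) ys = cong (x ∷_) (take-suc-length-++ xs ys)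

  ∷ʳ-cancel-↭ : ∀ (xs : List A) {y z} → xs ++ [ y ] ↭ xs ++ [ z ] → y ≡ z
  ∷ʳ-cancel-↭ [] p = ∷-injectiveˡ (↭-singleton-inv p)
  ∷ʳ-cancel-↭ (x ∷ xs) p = ∷ʳ-cancel-↭ xs (drop-∷ p)

module DecPartialOrderLists {A : Set} {_≼_ : A → A → Set}
  (isPartialOrder : IsPartialOrder _≡_ _≼_) (_≼?_ : Decidable _≼_) where

  open IsPartialOrder isPartialOrder using (antisym) renaming (refl to ≼-refl; trans to ≼-trans)

  Minimal : List A → A → Set
  Minimal xs m = All (λ z → z ≼ m → z ≡ m) xs

  private
    minimal-search : ∀ a xs → ∃ λ m → m ∈ a ∷ xs × m ≼ a × Minimal xs m
    minimal-search a [] = a , here refl , ≼-refl , []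
    minimal-search a (y ∷ ys) with m , m∈ , m≼a , min ← minimal-search a ys | y ≼? m
    ... | no y⋠m = m , skip-y m∈ , m≼a , (⊥-elim ∘ y⋠m) ∷ min
      where
        skip-y : m ∈ a ∷ ys → m ∈ a ∷ y ∷ ys
        skip-y (here m≡a) = here m≡a
        skip-y (there m∈ys) = there (there m∈ys)
    ... | yes y≼m with m′ , m′∈ , m′≼y , min′ ← minimal-search y ys =
      m′ , there m′∈ , ≼-trans m′≼y (≼-trans y≼m m≼a) , (λ y≼m′ → antisym y≼m′ m′≼y) ∷ min′

  minimal-below : ∀ {a xs} → a ∈ xs → ∃ λ m → m ∈ xs × m ≼ a × Minimal xs m
  minimal-below {a} {xs} a∈xs with m , m∈ , m≼a , min ← minimal-search a xs =
    m , drop-a m∈ , m≼a , min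
    where
      drop-a : m ∈ a ∷ xs → m ∈ xs
      drop-a (here refl) = a∈xs
      drop-a (there m∈xs) = m∈xs

  Ordered : List A → Set
  Ordered = AllPairs (λ x y → y ≼ x → y ≡ x)

  insert : A → List A → List A
  insert x [] = [ x ]
  insert x (y ∷ ys) with x ≼? y
  ... | yes _ = x ∷ y ∷ ys
  ... | no _ = y ∷ insert x ys

  insert-↭ : ∀ x ys → insert x ys ↭ x ∷ ys
  insert-↭ x [] = refl
  insert-↭ x (y ∷ ys) with x ≼? y
  ... | yes _ = refl
  ... | no _ = trans (prep y (insert-↭ x ys)) (swap y x refl)

  insert-ordered : ∀ x {ys} → Ordered ys → Ordered (insert x ys)
  insert-ordered x [] = [] ∷ []
  insert-ordered x {y ∷ ys} (py ∷ pys) with x ≼? y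
  ... | yes x≼y = ((λ y≼x → antisym y≼x x≼y) ∷ All.map below-y py) ∷ py ∷ pys
    where
      below-y : ∀ {z} → (z ≼ y → z ≡ y) → z ≼ x → z ≡ x
      below-y {z} f z≼x with refl ← f (≼-trans z≼x x≼y) = antisym z≼x x≼y
  ... | no x⋠y = All-resp-↭ (↭-sym (insert-↭ x ys)) ((⊥-elim ∘ x⋠y) ∷ py)
               ∷ insert-ordered x pys

  sort : List A → List A
  sort = foldr insert []

  sort-↭ : ∀ xs → sort xs ↭ xs
  sort-↭ [] = refl
  sort-↭ (x ∷ xs) = trans (insert-↭ x (sort xs)) (prep x (sort-↭ xs))

  sort-ordered : ∀ xs → Ordered (sort xs)
  sort-ordered [] = []
  sort-ordered (x ∷ xs) = insert-ordered x (sort-ordered xs)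

  lookup-ordered : ∀ {xs} → Ordered xs → ∀ a b →
    lookup xs a ≼ lookup xs b → lookup xs a ≢ lookup xs b → a <ᶠ b
  lookup-ordered {x ∷ xs} _ Fin.zero Fin.zero _ x≢x = ⊥-elim (x≢x refl)
  lookup-ordered {x ∷ xs} _ Fin.zero (Fin.suc b) _ _ = s≤s z≤n
  lookup-ordered {x ∷ xs} (px ∷ _) (Fin.suc a) Fin.zero a≼x a≢x =
    ⊥-elim (a≢x (All.lookup px (∈-lookup a) a≼x))
  lookup-ordered {x ∷ xs} (_ ∷ pxs) (Fin.suc a) (Fin.suc b) a≼b a≢b =
    s≤s (lookup-ordered pxs a b a≼b a≢b)

module _ {n : ℕ} (P : FinPoset n) where

  private
    _≼_ : Fin n → Fin n → Set
    _≼_ = _≤P_ P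

  open IsDecPartialOrder (isDecPartialOrder P)
    using (isPartialOrder; reflexive) renaming (trans to ≼-trans)
  open DecPartialOrderLists isPartialOrder (_≤?_ P)
  open DecPartialOrderLists (Flip.isPartialOrder isPartialOrder) (flip (_≤?_ P))
    using () renaming (minimal-below to maximal-above)
  open DecMembership (Fin._≟_ {n}) using (_∈?_)

  _∥_ : Fin n → Fin n → Set
  a ∥ b = ¬ a ≼ b × ¬ b ≼ a

  ordered⇒IsLinExt : ∀ {l} → l ↭ allFin n → Ordered l → IsLinExt P l
  ordered⇒IsLinExt l↭ ordered = l↭ , λ a b (a≼b , a≢b) → lookup-ordered ordered a b a≼b a≢b

  bkAt-incomparable : ∀ pre {a b} rest → a ∥ b →
    bkAt P (length pre) (pre ++ a ∷ b ∷ rest) ≡ pre ++ b ∷ a ∷ rest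
  bkAt-incomparable [] {a} {b} rest (a⋠b , b⋠a) with _≤?_ P a b | _≤?_ P b a
  ... | no _ | no _ = refl
  ... | yes a≼b | _ = ⊥-elim (a⋠b a≼b)
  ... | no _ | yes b≼a = ⊥-elim (b⋠a b≼a)
  bkAt-incomparable (x ∷ pre) rest a∥b = cong (x ∷_) (bkAt-incomparable pre rest a∥b)

  take-bkAt : ∀ k m l → suc k ≢ m → take m (bkAt P k l) ↭ take m l
  take-bkAt k zero l _ = refl
  take-bkAt zero (suc zero) l 1≢1 = ⊥-elim (1≢1 refl)
  take-bkAt zero (suc (suc m)) [] _ = refl
  take-bkAt zero (suc (suc m)) (x ∷ []) _ = refl
  take-bkAt zero (suc (suc m)) (x ∷ y ∷ l) _ with _≤?_ P x y | _≤?_ P y x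
  ... | no _ | no _ = swap y x refl
  ... | yes _ | _ = refl
  ... | no _ | yes _ = refl
  take-bkAt (suc k) (suc m) [] _ = refl
  take-bkAt (suc k) (suc m) (x ∷ l) k+2≢m+1 = prep x (take-bkAt k m l (k+2≢m+1 ∘ cong suc))

  take-act : ∀ {j} w l → All (_≢ j) w → take j (act P w l) ↭ take j l
  take-act [] l [] = refl
  take-act (zero ∷ w) l (_ ∷ avoid) = take-act w l avoid
  take-act (suc k ∷ w) l (k+1≢j ∷ avoid) =
    trans (take-bkAt k _ (act P w l) k+1≢j) (take-act w l avoid)

  act-avoiding-swap⇒≡ : ∀ pre {a b} rest w → All (_≢ suc (length pre)) w →
    act P w (pre ++ a ∷ b ∷ rest) ≡ pre ++ b ∷ a ∷ rest → b ≡ a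
  act-avoiding-swap⇒≡ pre {a} {b} rest w avoid swapped = ∷ʳ-cancel-↭ pre (begin
    pre ++ [ b ]                   ≡⟨ take-suc-length-++ pre (a ∷ rest) ⟨
    take j (pre ++ b ∷ a ∷ rest)   ≡⟨ cong (take j) swapped ⟨
    take j (act P w l)             ↭⟨ take-act w l avoid ⟩
    take j l                       ≡⟨ take-suc-length-++ pre (b ∷ rest) ⟩
    pre ++ [ a ]                   ∎)
    where
      open PermutationReasoning
      j = suc (length pre)
      l = pre ++ a ∷ b ∷ rest

  ordinalSum⇒Decomposable : ∀ {x u} {D U : List (Fin n)} → D ++ U ↭ allFin n →
    x ∈ D → u ∈ U → All (λ d → All (d ≼_) U) D → Decomposable P
  ordinalSum⇒Decomposable {x} {u} {D} {U} D++U↭ x∈D u∈U below =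
    inD , (x , Equivalence.to T-≡ (fromWitness x∈D))
        , (u , Equivalence.to T-not-≡ (fromWitnessFalse u∉D)) , D-below-rest
    where
      inD : Fin n → Bool
      inD y = isYes (y ∈? D)

      unique : Unique (D ++ U)
      unique = Perm.Unique-resp-↭ (setoid (Fin n)) (↭⇒↭ₛ (↭-sym D++U↭)) (allFin⁺ n)

      disjoint : All (λ y → All (y ≢_) U) D
      disjoint = proj₂ (proj₂ (AllPairs-++⁻ D unique))

      cover : ∀ y → y ∈ D ++ U
      cover y = ∈-resp-↭ (↭-sym D++U↭) (∈-allFin y)

      u∉D : u ∉ D
      u∉D u∈D = All.lookup (All.lookup disjoint u∈D) u∈U refl

      D-below-rest : ∀ y z → inD y ≡ true → inD z ≡ false → _<P_ P y z
      D-below-rest y z y∈ z∉ = All.lookup (All.lookup below y∈D) z∈U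
                             , λ y≡z → z∉D (subst (_∈ D) y≡z y∈D)
        where
          y∈D = toWitness (Equivalence.from T-≡ y∈)
          z∉D = toWitnessFalse (Equivalence.from T-not-≡ z∉)
          z∈U = fromInj₂ (⊥-elim ∘ z∉D) (∈-++⁻ D (cover z))

  crossing-pair : Indecomposable P → ∀ {x u} {D U : List (Fin n)} → D ++ U ↭ allFin n →
    x ∈ D → u ∈ U → ∃₂ λ d u → d ∈ D × u ∈ U × ¬ d ≼ u
  crossing-pair indecomposable {D = D} {U} D++U↭ x∈D u∈U
    with All.all? (λ d → All.all? (_≤?_ P d) U) D
  ... | yes below = ⊥-elim (indecomposable (ordinalSum⇒Decomposable D++U↭ x∈D u∈U below))
  ... | no ¬below =
    let d , d∈D , ¬d≼U = find (All.¬All⇒Any¬ (λ d → All.all? (_≤?_ P d) U) D ¬below)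
        u , u∈U , d⋠u = find (All.¬All⇒Any¬ (_≤?_ P d) U ¬d≼U)
    in d , u , d∈D , u∈U , d⋠u

  incomparable-rearrangement : ∀ {D U d u} → Ordered (D ++ U) → d ∈ D → u ∈ U → ¬ d ≼ u →
    ∃ λ pre → ∃₂ λ a b → ∃ λ rest → suc (length pre) ≡ length D × a ∥ b ×
      Ordered (pre ++ a ∷ b ∷ rest) × pre ++ a ∷ b ∷ rest ↭ D ++ U
  incomparable-rearrangement {D} {U} ordered d∈D u∈U d⋠u
    with d′ , d′∈D , d≼d′ , d′-maximal ← maximal-above d∈D
       | u′ , u′∈U , u′≼u , u′-minimal ← minimal-below u∈U
       | orderedD , orderedU , D-before-U ← AllPairs-++⁻ D ordered
    with A₁ , A₂ , refl ← ∈-∃++ d′∈D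
       | B₁ , B₂ , refl ← ∈-∃++ u′∈U
    = A₁ ++ A₂ , d′ , u′ , B₁ ++ B₂
    , sym (↭-length (shift d′ A₁ A₂)) , (d′⋠u′ , u′⋠d′) , ordered′ , permutation
    where
      d′⋠u′ : ¬ d′ ≼ u′
      d′⋠u′ d′≼u′ = d⋠u (≼-trans d≼d′ (≼-trans d′≼u′ u′≼u))

      u′⋠d′ : ¬ u′ ≼ d′
      u′⋠d′ u′≼d′ =
        d′⋠u′ (reflexive (sym (All.lookup (All.lookup D-before-U d′∈D) u′∈U u′≼d′)))

      U-to-front : ∀ {Q : Fin n → Set} → All Q (B₁ ++ u′ ∷ B₂) → All Q (u′ ∷ B₁ ++ B₂)
      U-to-front = All-resp-↭ (shift u′ B₁ B₂)

      ordered′ : Ordered ((A₁ ++ A₂) ++ d′ ∷ u′ ∷ B₁ ++ B₂)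
      ordered′ = AllPairs.++⁺ (AllPairs-remove A₁ orderedD)
        (U-to-front (All.lookup D-before-U d′∈D)
          ∷ All-remove B₁ u′-minimal ∷ AllPairs-remove B₁ orderedU)
        (All.zipWith (λ (d′-max , x-before-U) → (sym ∘ d′-max) ∷ U-to-front x-before-U)
          (All-remove A₁ d′-maximal , All-remove A₁ D-before-U))

      permutation : (A₁ ++ A₂) ++ d′ ∷ u′ ∷ B₁ ++ B₂ ↭ (A₁ ++ d′ ∷ A₂) ++ B₁ ++ u′ ∷ B₂
      permutation = begin
        (A₁ ++ A₂) ++ d′ ∷ u′ ∷ B₁ ++ B₂  ↭⟨ ++⁺ˡ (A₁ ++ A₂) (prep d′ (↭-sym (shift u′ B₁ B₂))) ⟩
        (A₁ ++ A₂) ++ d′ ∷ U             ↭⟨ shift d′ (A₁ ++ A₂) U ⟩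
        d′ ∷ (A₁ ++ A₂) ++ U             ≡⟨ cong (d′ ∷_) (++-assoc A₁ A₂ U) ⟩
        d′ ∷ A₁ ++ A₂ ++ U               ↭⟨ shift d′ A₁ (A₂ ++ U) ⟨
        A₁ ++ d′ ∷ A₂ ++ U               ≡⟨ ++-assoc A₁ (d′ ∷ A₂) U ⟨
        (A₁ ++ d′ ∷ A₂) ++ U             ∎
        where
          open PermutationReasoning

  incomparable-in-linExt : Indecomposable P → ∀ {l} k → l ↭ allFin n → Ordered l →
    suc k < length l →
    ∃ λ pre → ∃₂ λ a b → ∃ λ rest → length pre ≡ k × a ∥ b × IsLinExt P (pre ++ a ∷ b ∷ rest)
  incomparable-in-linExt indecomposable {l} k l↭ ordered k+1<|l|
    with x ∷ D , u₀ , U , refl , refl ← split-at (suc k) l k+1<|l|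
    with d , u , d∈D , u∈U , d⋠u ← crossing-pair indecomposable l↭ (here refl) (here refl)
    with pre , a , b , rest , |pre|≡|D| , a∥b , ordered′ , permutation
           ← incomparable-rearrangement ordered d∈D u∈U d⋠u
    = pre , a , b , rest , suc-injective |pre|≡|D| , a∥b
    , ordered⇒IsLinExt (trans permutation l↭) ordered′

  adjacent-incomparable : Indecomposable P → ∀ k → suc (suc k) ≤ n →
    ∃ λ pre → ∃₂ λ a b → ∃ λ rest → length pre ≡ k × a ∥ b × IsLinExt P (pre ++ a ∷ b ∷ rest)
  adjacent-incomparable indecomposable k 2+k≤n =
    incomparable-in-linExt indecomposable k (sort-↭ (allFin n)) (sort-ordered (allFin n))
      (subst (suc k <_) (sym |sort-allFin|≡n) 2+k≤n)
    where
      |sort-allFin|≡n : length (sort (allFin n)) ≡ n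
      |sort-allFin|≡n = ≡-trans (↭-length (sort-↭ (allFin n))) (length-tabulate id)

corollary3p3 : (n : ℕ) (P : FinPoset n) → Indecomposable P → MinimalGenerating P
corollary3p3 n P indecomposable = (λ w valid → w , valid , λ _ _ → refl) , irredundant
  where
    irredundant : ∀ j → ValidIndex n j → ¬ Generates P (λ i → ValidIndex n i × i ≢ j)
    irredundant zero (() , _)
    irredundant (suc k) valid@(_ , 2+k≤n) generated
      with pre , a , b , rest , refl , a∥b , linExt
             ← adjacent-incomparable P indecomposable k 2+k≤n
      with w , avoids-j , tⱼ≗w ← generated (suc k ∷ []) (valid ∷ [])
      = proj₂ a∥b (IsDecPartialOrder.reflexive (isDecPartialOrder P)
          (act-avoiding-swap⇒≡ P pre rest w (All.map proj₂ avoids-j)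
            (≡-trans (sym (tⱼ≗w _ linExt)) (bkAt-incomparable P pre rest a∥b))))
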